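{- For any two simple graphs $G,F$ and any positive integer $k$, $$\mathrm{wsat}(G,F)\geq\frac{1}{k}\cdot\mathrm{rk}\text{ - }\mathrm{sat}\left(G^k,\{F^k_e:\ e\in E(F)\}\right).$$
   Context: For a simple graph $G$, $G^k$ is the multigraph obtained from $G$ by including $k$ instances of every edge of $G$. For $e\in E(F)$, $F^k_e$ is the multigraph containing each edge of $E(F)\setminus\{e\}$ exactly $k$ times and the edge $e$ once. $\mathrm{wsat}(G,F)$ is the minimum number of edges of a spanning subgraph $H$ of $G$ such that the edges of $G$ missing from $H$ can be added one at a time, each added edge creating a copy of $F$. For multigraphs: edges are a multiset of pairs, distinct instances are distinct edges; a matroid on $E(G^k)$ is weakly $\mathcal{F}$-saturated (for a family $\mathcal{F}$ of multigraphs) if every copy $\tilde F$ in $G^k$ of every member of $\mathcal F$ is a cycle, i.e. $\mathrm{rk}_M(E(\tilde F)\setminus\{e\})=\mathrm{rk}_M(E(\tilde F))$ for all $e\in E(\tilde F)$; $\mathrm{rk}\text{ - }\mathrm{sat}(G^k,\mathcal{F})$ is the maximum rank of such a matroid. -}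

module Defs where

open import Data.Nat using (ℕ; _+_; _*_; _≤_; _<_)
open import Data.Fin using (Fin; toℕ)
open import Data.Fin.Properties using (any?)
open import Data.Fin.Subset using (Subset; ⊤; ⁅_⁆; _∈_; _∉_; _⊆_; _∪_; _∩_; _-_; ∣_∣)
open import Data.Bool using (Bool; true; false; if_then_else_)
open import Data.List using (List; length; lookup; concatMap; replicate; tabulate; [_])
open import Data.List.Relation.Unary.All using (All)
open import Data.List.Relation.Unary.Unique.Propositional using (Unique)
open import Data.Product using (_×_; _,_; proj₁; proj₂; ∃)
open import Data.Sum using (_⊎_)
open import Data.Vec using () renaming (tabulate to vtabulate)
open import Function.Definitions using (Injective)
open import Relation.Binary.PropositionalEquality using (_≡_)
open import Relation.Nullary.Decidable using (⌊_⌋)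
open import Data.Fin using (_≟_)

-- A simple graph: a duplicate-free list of edges {i,j}, each stored as
-- an ordered pair (i , j) with i < j (so loops and parallel edges are
-- impossible and each 2-subset is stored in exactly one way).
record SimpleGraph (n : ℕ) : Set where
  field
    edges   : List (Fin n × Fin n)
    ordered : All (λ p → toℕ (proj₁ p) < toℕ (proj₂ p)) edges
    unique  : Unique edges
open SimpleGraph public

-- A multigraph: a list of edges; distinct list positions are distinct
-- edges (so the edge set is a multiset of pairs).  Edge x has endpoints
-- lookup M x.
Multigraph : ℕ → Set
Multigraph n = List (Fin n × Fin n)

#E : ∀ {n} → Multigraph n → ℕ
#E M = length M

mg : ∀ {n} → SimpleGraph n → Multigraph n
mg G = edges G

_^[_] : ∀ {n} → SimpleGraph n → ℕ → Multigraph n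
G ^[ k ] = concatMap (replicate k) (edges G)

Fke : ∀ {m} → (F : SimpleGraph m) → ℕ → Fin (length (edges F)) → Multigraph m
Fke F k e = concatMap
  (λ f → if ⌊ f ≟ e ⌋ then [ lookup (edges F) f ] else replicate k (lookup (edges F) f))
  (tabulate {n = length (edges F)} (λ f → f))

SameEdge : ∀ {n} → Fin n × Fin n → Fin n × Fin n → Set
SameEdge (a , b) (c , d) = (a ≡ c × b ≡ d) ⊎ (a ≡ d × b ≡ c)

record Copy {m n} (H : Multigraph m) (M : Multigraph n) : Set where
  field
    φ     : Fin m → Fin n
    φ-inj : Injective _≡_ _≡_ φ
    ψ     : Fin (#E H) → Fin (#E M)
    ψ-inj : Injective _≡_ _≡_ ψ
    ψ-end : ∀ x → SameEdge (φ (proj₁ (lookup H x)) , φ (proj₂ (lookup H x)))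
                           (lookup M (ψ x))
open Copy public

edgeSet : ∀ {m n} {H : Multigraph m} {M : Multigraph n} → Copy H M → Subset (#E M)
edgeSet c = vtabulate (λ y → ⌊ any? (λ x → ψ c x ≟ y) ⌋)

-- WeaklySat G F S : starting from the spanning subgraph of G with edge
-- set S, the missing edges of G can be added one at a time, each added
-- edge e creating a (new) copy of F, i.e. a copy of F in the current
-- graph S ∪ {e} which uses the edge e.
data WeaklySat {n m} (G : SimpleGraph n) (F : SimpleGraph m)
     : Subset (#E (mg G)) → Set where
  done : WeaklySat G F ⊤
  step : ∀ (S : Subset (#E (mg G))) (e : Fin (#E (mg G))) → e ∉ S →
         (c : Copy (mg F) (mg G)) →
         (∀ x → ψ c x ∈ (S ∪ ⁅ e ⁆)) →
         ∃ (λ x → ψ c x ≡ e) →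
         WeaklySat G F (S ∪ ⁅ e ⁆) →
         WeaklySat G F S

record Matroid (N : ℕ) : Set where
  field
    rk        : Subset N → ℕ
    rk-card   : ∀ X → rk X ≤ ∣ X ∣
    rk-mono   : ∀ X Y → X ⊆ Y → rk X ≤ rk Y
    rk-submod : ∀ X Y → rk (X ∪ Y) + rk (X ∩ Y) ≤ rk X + rk Y
open Matroid public

rank : ∀ {N} → Matroid N → ℕ
rank M = rk M ⊤

-- X is a cycle (in the paper's sense): removing any element keeps the rank
IsCycle : ∀ {N} → Matroid N → Subset N → Set
IsCycle M X = ∀ y → y ∈ X → rk M (X - y) ≡ rk M X

WeaklySatMatroid : ∀ {n m} (G : SimpleGraph n) (F : SimpleGraph m) (k : ℕ) →
                   Matroid (#E (G ^[ k ])) → Set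
WeaklySatMatroid G F k M =
  ∀ (e : Fin (#E (mg F))) (c : Copy (Fke F k e) (G ^[ k ])) → IsCycle M (edgeSet c)

{-# OPTIONS --safe #-}
-- Follow a weak-saturation sequence H = S₀ ⊂ S₁ ⊂ … ⊂ E(G) inside G^k.  When an edge e
-- is added through a copy of F using e, then for each layer j that copy extends to a copy
-- of F^k_e in G^k whose single e-edge is the j-th copy of e and whose other edges are
-- copies of edges already present.  That copy is a cycle of M, so the j-th copy of e lies
-- in the closure of the copies of the current edge set.  Hence all of E(G^k) lies in the
-- closure of the k·|H| copies of edges of H, and rank M ≤ k·|H|.
module Submission where

open import Defs
open import Data.Nat using (ℕ; _*_; _≤_)
open import Data.Fin.Subset using (Subset; ∣_∣)

open import Data.Bool using (Bool; true; if_then_else_)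
open import Data.Nat using (_+_)
open import Data.Fin using (Fin; zero; suc; cast; _≟_)
import Data.Fin as Fin
open import Data.Fin.Properties using (cast-is-id; cast-involutive; splitAt-join; join-splitAt)
open import Data.Fin.Subset using (⊤; ⊥; ⁅_⁆; _∈_; _∉_; _⊆_; _∪_; _∩_; _─_; _-_; inside; outside)
open import Data.Fin.Subset.Properties
  using (∈⊤; ⊥⊆; ∣⊥∣≡0; ⊆-trans; p⊆p∪q; q⊆p∪q; x∈p∪q⁻; x∈p∩q⁺; p─q⊆p; x∈⁅x⁆; x∈⁅y⁆⇒x≡y; ∣⊤∣≡n; ∣⁅x⁆∣≡1)
open import Data.List using (List; []; _∷_; [_]; _++_; length; lookup; concatMap; replicate; tabulate)
open import Data.List.Properties using (length-++; length-replicate; lookup-replicate; length-tabulate; lookup-tabulate)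
open import Data.Nat.Properties using (≤-trans; ≤-reflexive; m≤m+n; +-mono-≤; +-cancelʳ-≤; *-suc; *-zeroʳ; *-identityˡ; module ≤-Reasoning)
open import Data.Product using (Σ-syntax; ∃; _×_; _,_; proj₁; proj₂)
open import Data.Sum using (_⊎_; inj₁; inj₂; [_,_]′)
import Data.Vec as Vec
open import Data.Vec using ([]; _∷_; here; there)
open import Data.Vec.Properties using (lookup∘tabulate; []=⇒lookup; lookup⇒[]=)
open import Function using (_∘_; id)
open import Function.Bundles using (Equivalence)
open import Function.Definitions using (Injective)
open import Data.Bool.Properties using (T-≡)
open import Relation.Nullary using (yes; no; contradiction)
open import Relation.Nullary.Decidable using (⌊_⌋; fromWitness; toWitness)
open import Relation.Binary.PropositionalEquality using (_≡_; refl; sym; trans; cong; subst; subst₂; cong₂; module ≡-Reasoning)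

module _ {B : Set} (xs ys : List B) where

  ++-join : Fin (length xs) ⊎ Fin (length ys) → Fin (length (xs ++ ys))
  ++-join = cast (sym (length-++ xs)) ∘ Fin.join (length xs) (length ys)

  ++-split : Fin (length (xs ++ ys)) → Fin (length xs) ⊎ Fin (length ys)
  ++-split = Fin.splitAt (length xs) ∘ cast (length-++ xs)

  ++-split-join : ∀ s → ++-split (++-join s) ≡ s
  ++-split-join s =
    trans (cong (Fin.splitAt (length xs)) (cast-involutive (length-++ xs) (sym (length-++ xs)) _))
          (splitAt-join (length xs) (length ys) s)

  ++-join-split : ∀ y → ++-join (++-split y) ≡ y
  ++-join-split y =
    trans (cong (cast _) (join-splitAt (length xs) (length ys) _))
          (cast-involutive (sym (length-++ xs)) (length-++ xs) y)

lookup-++-join : ∀ {B : Set} (xs ys : List B) s →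
                 lookup (xs ++ ys) (++-join xs ys s) ≡ [ lookup xs , lookup ys ]′ s
lookup-++-join []       ys (inj₂ j)       = cong (lookup ys) (cast-is-id _ j)
lookup-++-join (x ∷ xs) ys (inj₁ zero)    = refl
lookup-++-join (x ∷ xs) ys (inj₁ (suc i)) = lookup-++-join xs ys (inj₁ i)
lookup-++-join (x ∷ xs) ys (inj₂ j)       = lookup-++-join xs ys (inj₂ j)

lookup-replicate′ : ∀ {B : Set} k (a : B) t → lookup (replicate k a) t ≡ a
lookup-replicate′ k a t =
  trans (cong (lookup (replicate k a))
              (sym (cast-involutive (sym (length-replicate k)) (length-replicate k) t)))
        (lookup-replicate k a _)

lookup-tabulate′ : ∀ {B : Set} {n} (f : Fin n → B) i →
                   lookup (tabulate f) i ≡ f (cast (length-tabulate f) i)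
lookup-tabulate′ f i =
  trans (cong (lookup (tabulate f))
              (sym (cast-involutive (sym (length-tabulate f)) (length-tabulate f) i)))
        (lookup-tabulate f _)

lookup-tabulate-injective : ∀ {B : Set} {n} {f : Fin n → B} →
                            Injective _≡_ _≡_ f → Injective _≡_ _≡_ (lookup (tabulate f))
lookup-tabulate-injective {f = f} f-inj {i} {i′} eq = begin
  i                                     ≡⟨ cast-involutive (sym (length-tabulate f)) (length-tabulate f) i ⟨
  cast _ (cast (length-tabulate f) i)   ≡⟨ cong (cast _) (f-inj f-cast-i≡f-cast-i′) ⟩
  cast _ (cast (length-tabulate f) i′)  ≡⟨ cast-involutive (sym (length-tabulate f)) (length-tabulate f) i′ ⟩
  i′                                    ∎
  where
  open ≡-Reasoning
  f-cast-i≡f-cast-i′ = trans (sym (lookup-tabulate′ f i)) (trans eq (lookup-tabulate′ f i′))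

module ConcatMapPosition {A B : Set} (g : A → List B) where

  Position : List A → Set
  Position L = Σ[ i ∈ Fin (length L) ] Fin (length (g (lookup L i)))

  shift : ∀ {a L} → Position L → Position (a ∷ L)
  shift (i , j) = suc i , j

  join : ∀ L → Position L → Fin (length (concatMap g L))
  join (a ∷ L) (zero  , j) = ++-join (g a) (concatMap g L) (inj₁ j)
  join (a ∷ L) (suc i , j) = ++-join (g a) (concatMap g L) (inj₂ (join L (i , j)))

  split : ∀ L → Fin (length (concatMap g L)) → Position L
  split (a ∷ L) y = [ zero ,_ , shift ∘ split L ]′ (++-split (g a) (concatMap g L) y)

  split-join : ∀ L p → split L (join L p) ≡ p
  split-join (a ∷ L) (zero , j) = cong [ zero ,_ , shift ∘ split L ]′ (++-split-join (g a) _ (inj₁ j))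
  split-join (a ∷ L) (suc i , j) =
    trans (cong [ zero ,_ , shift ∘ split L ]′ (++-split-join (g a) _ (inj₂ _)))
          (cong shift (split-join L (i , j)))

  join-split : ∀ L y → join L (split L y) ≡ y
  join-split (a ∷ L) y with ++-split (g a) (concatMap g L) y | ++-join-split (g a) (concatMap g L) y
  ... | inj₁ j | eq = eq
  ... | inj₂ z | eq = trans (cong (++-join (g a) _ ∘ inj₂) (join-split L z)) eq

  split-injective : ∀ L → Injective _≡_ _≡_ (split L)
  split-injective L {y} {y′} eq = trans (sym (join-split L y)) (trans (cong (join L) eq) (join-split L y′))

  lookup-join : ∀ L p → lookup (concatMap g L) (join L p) ≡ lookup (g (lookup L (proj₁ p))) (proj₂ p)
  lookup-join (a ∷ L) (zero  , j) = lookup-++-join (g a) _ (inj₁ j)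
  lookup-join (a ∷ L) (suc i , j) = trans (lookup-++-join (g a) _ (inj₂ _)) (lookup-join L (i , j))

  lookup-split : ∀ L y →
                 lookup (concatMap g L) y ≡ lookup (g (lookup L (proj₁ (split L y)))) (proj₂ (split L y))
  lookup-split L y = trans (cong (lookup (concatMap g L)) (sym (join-split L y))) (lookup-join L (split L y))

∈-tabulate⁺ : ∀ {n} {f : Fin n → Bool} {y} → f y ≡ true → y ∈ Vec.tabulate f
∈-tabulate⁺ {f = f} {y} fy = lookup⇒[]= y (Vec.tabulate f) (trans (lookup∘tabulate f y) fy)

∈-tabulate⁻ : ∀ {n} {f : Fin n → Bool} {y} → y ∈ Vec.tabulate f → f y ≡ true
∈-tabulate⁻ {f = f} {y} y∈ = trans (sym (lookup∘tabulate f y)) ([]=⇒lookup y∈)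

preimage : ∀ {n N} → (Fin N → Fin n) → Subset n → Subset N
preimage f S = Vec.tabulate (Vec.lookup S ∘ f)

module _ {n N} {f : Fin N → Fin n} {S : Subset n} {y : Fin N} where

  ∈-preimage⁺ : f y ∈ S → y ∈ preimage f S
  ∈-preimage⁺ fy∈S = ∈-tabulate⁺ ([]=⇒lookup fy∈S)

  ∈-preimage⁻ : y ∈ preimage f S → f y ∈ S
  ∈-preimage⁻ y∈ = lookup⇒[]= (f y) S (∈-tabulate⁻ y∈)

∪-lub : ∀ {n} {p q r : Subset n} → p ⊆ r → q ⊆ r → p ∪ q ⊆ r
∪-lub {p = p} {q} p⊆r q⊆r x∈p∪q with x∈p∪q⁻ p q x∈p∪q
... | inj₁ x∈p = p⊆r x∈p
... | inj₂ x∈q = q⊆r x∈q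

x∈p─q⇒x∉q : ∀ {n} (p q : Subset n) {x} → x ∈ p ─ q → x ∉ q
x∈p─q⇒x∉q (inside  ∷ p) (inside ∷ q) () here
x∈p─q⇒x∉q (outside ∷ p) (inside ∷ q) () here
x∈p─q⇒x∉q (_ ∷ p) (_ ∷ q) (there x∈p─q) (there x∈q) = x∈p─q⇒x∉q p q x∈p─q x∈q

⋃∈ : ∀ {n N} → Subset n → (Fin n → Subset N) → Subset N
⋃∈ []            f = ⊥
⋃∈ (inside  ∷ T) f = f zero ∪ ⋃∈ T (f ∘ suc)
⋃∈ (outside ∷ T) f = ⋃∈ T (f ∘ suc)

syntax ⋃∈ T (λ i → f) = ⋃[ i ∈ T ] f

∈-⋃⁺ : ∀ {n N} (T : Subset n) (f : Fin n → Subset N) {i y} →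
       i ∈ T → y ∈ f i → y ∈ ⋃[ i ∈ T ] f i
∈-⋃⁺ (inside  ∷ T) f here       y∈ = p⊆p∪q (⋃∈ T (f ∘ suc)) y∈
∈-⋃⁺ (inside  ∷ T) f (there i∈) y∈ = q⊆p∪q (f zero) _ (∈-⋃⁺ T (f ∘ suc) i∈ y∈)
∈-⋃⁺ (outside ∷ T) f (there i∈) y∈ = ∈-⋃⁺ T (f ∘ suc) i∈ y∈

module _ {m n} {H : Multigraph m} {K : Multigraph n} (c : Copy H K) where

  ∈-edgeSet⁺ : ∀ x → ψ c x ∈ edgeSet c
  ∈-edgeSet⁺ x = ∈-tabulate⁺ (Equivalence.to T-≡ (fromWitness (x , refl)))

  ∈-edgeSet⁻ : ∀ {z} → z ∈ edgeSet c → ∃ λ x → ψ c x ≡ z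
  ∈-edgeSet⁻ z∈ = toWitness (Equivalence.from T-≡ (∈-tabulate⁻ z∈))

Spans : ∀ {N} → Matroid N → Subset N → Subset N → Set
Spans M A B = rk M (A ∪ B) ≤ rk M A

module _ {N} (M : Matroid N) where
  open ≤-Reasoning

  rk-∪-≤ : ∀ X Y → rk M (X ∪ Y) ≤ rk M X + rk M Y
  rk-∪-≤ X Y = ≤-trans (m≤m+n _ _) (rk-submod M X Y)

  rk-⋃-≤ : ∀ {n} c (T : Subset n) (f : Fin n → Subset N) →
           (∀ i → rk M (f i) ≤ c) → rk M (⋃[ i ∈ T ] f i) ≤ c * ∣ T ∣
  rk-⋃-≤ c [] f _ = ≤-trans (rk-card M ⊥) (≤-reflexive (trans (∣⊥∣≡0 N) (sym (*-zeroʳ c))))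
  rk-⋃-≤ c (inside ∷ T) f rk-f≤c = begin
    rk M (f zero ∪ ⋃∈ T (f ∘ suc))         ≤⟨ rk-∪-≤ (f zero) _ ⟩
    rk M (f zero) + rk M (⋃∈ T (f ∘ suc))  ≤⟨ +-mono-≤ (rk-f≤c zero) (rk-⋃-≤ c T (f ∘ suc) (rk-f≤c ∘ suc)) ⟩
    c + c * ∣ T ∣                          ≡⟨ *-suc c ∣ T ∣ ⟨
    c * ∣ inside ∷ T ∣                     ∎
  rk-⋃-≤ c (outside ∷ T) f rk-f≤c = rk-⋃-≤ c T (f ∘ suc) (rk-f≤c ∘ suc)

  spans-∪ : ∀ {A B C} → Spans M A B → Spans M A C → Spans M A (B ∪ C)
  spans-∪ {A} {B} {C} A⊢B A⊢C = +-cancelʳ-≤ (rk M A) _ _ (begin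
    rk M (A ∪ (B ∪ C)) + rk M A    ≤⟨ +-mono-≤ (rk-mono M _ _ A∪B∪C⊆P∪Q) (rk-mono M _ _ A⊆P∩Q) ⟩
    rk M (P ∪ Q) + rk M (P ∩ Q)    ≤⟨ rk-submod M P Q ⟩
    rk M P + rk M Q                ≤⟨ +-mono-≤ A⊢B A⊢C ⟩
    rk M A + rk M A                ∎)
    where
    P = A ∪ B
    Q = A ∪ C
    A∪B∪C⊆P∪Q : A ∪ (B ∪ C) ⊆ P ∪ Q
    A∪B∪C⊆P∪Q = ∪-lub (⊆-trans (p⊆p∪q B) (p⊆p∪q Q))
                  (∪-lub (⊆-trans (q⊆p∪q A B) (p⊆p∪q Q)) (⊆-trans (q⊆p∪q A C) (q⊆p∪q P Q)))
    A⊆P∩Q : A ⊆ P ∩ Q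
    A⊆P∩Q x∈A = x∈p∩q⁺ (p⊆p∪q B x∈A , p⊆p∪q C x∈A)

  spans-⋃ : ∀ {n A} (T : Subset n) (f : Fin n → Subset N) →
            (∀ {i} → i ∈ T → Spans M A (f i)) → Spans M A (⋃[ i ∈ T ] f i)
  spans-⋃ []            f _   = rk-mono M _ _ (∪-lub (λ x∈A → x∈A) ⊥⊆)
  spans-⋃ (inside  ∷ T) f A⊢f = spans-∪ (A⊢f here) (spans-⋃ T (f ∘ suc) (A⊢f ∘ there))
  spans-⋃ (outside ∷ T) f A⊢f = spans-⋃ T (f ∘ suc) (A⊢f ∘ there)

  cycle⇒spans : ∀ {X A y} → IsCycle M X → y ∈ X → X - y ⊆ A → Spans M A ⁅ y ⁆
  cycle⇒spans {X} {A} {y} X-cycle y∈X X-y⊆A = +-cancelʳ-≤ (rk M X) _ _ (begin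
    rk M (A ∪ ⁅ y ⁆) + rk M X       ≡⟨ cong (rk M (A ∪ ⁅ y ⁆) +_) (X-cycle y y∈X) ⟨
    rk M (A ∪ ⁅ y ⁆) + rk M (X - y) ≤⟨ +-mono-≤ (rk-mono M _ _ A∪y⊆A∪X) (rk-mono M _ _ X-y⊆A∩X) ⟩
    rk M (A ∪ X) + rk M (A ∩ X)     ≤⟨ rk-submod M A X ⟩
    rk M A + rk M X                 ∎)
    where
    A∪y⊆A∪X : A ∪ ⁅ y ⁆ ⊆ A ∪ X
    A∪y⊆A∪X = ∪-lub (p⊆p∪q X)
                (λ x∈⁅y⁆ → q⊆p∪q A X (subst (_∈ X) (sym (x∈⁅y⁆⇒x≡y y x∈⁅y⁆)) y∈X))
    X-y⊆A∩X : X - y ⊆ A ∩ X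
    X-y⊆A∩X x∈X-y = x∈p∩q⁺ (X-y⊆A x∈X-y , p─q⊆p X ⁅ y ⁆ x∈X-y)

module Blowup {X : Set} (k : ℕ) (L : List X) where
  open ConcatMapPosition (replicate {A = X} k)

  Lᵏ : List X
  Lᵏ = concatMap (replicate k) L

  origin : Fin (length Lᵏ) → Fin (length L)
  origin y = proj₁ (split L y)

  layer : Fin (length Lᵏ) → Fin k
  layer y = cast (length-replicate k) (proj₂ (split L y))

  copyAt : Fin (length L) → Fin k → Fin (length Lᵏ)
  copyAt i j = join L (i , cast (sym (length-replicate k)) j)

  origin-copyAt : ∀ i j → origin (copyAt i j) ≡ i
  origin-copyAt i j = cong proj₁ (split-join L _)

  layer-copyAt : ∀ i j → layer (copyAt i j) ≡ j
  layer-copyAt i j = trans (cong (λ p → cast (length-replicate k) (proj₂ p)) (split-join L _))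
                           (cast-involutive (length-replicate k) (sym (length-replicate k)) j)

  copyAt-origin-layer : ∀ y → copyAt (origin y) (layer y) ≡ y
  copyAt-origin-layer y =
    trans (cong (λ t → join L (origin y , t))
                (cast-involutive (sym (length-replicate k)) (length-replicate k) (proj₂ (split L y))))
          (join-split L y)

  lookup-origin : ∀ y → lookup Lᵏ y ≡ lookup L (origin y)
  lookup-origin y = trans (lookup-split L y) (lookup-replicate′ k (lookup L (origin y)) _)

  copyAt-injective : ∀ {i i′ j j′} → copyAt i j ≡ copyAt i′ j′ → i ≡ i′ × j ≡ j′
  copyAt-injective {i} {i′} {j} {j′} eq =
    trans (sym (origin-copyAt i j)) (trans (cong origin eq) (origin-copyAt i′ j′)) ,
    trans (sym (layer-copyAt i j)) (trans (cong layer eq) (layer-copyAt i′ j′))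

  lookup-copyAt : ∀ i j → lookup Lᵏ (copyAt i j) ≡ lookup L i
  lookup-copyAt i j = trans (lookup-origin (copyAt i j)) (cong (lookup L) (origin-copyAt i j))

  copies : Fin (length L) → Subset (length Lᵏ)
  copies i = ⋃[ j ∈ ⊤ ] ⁅ copyAt i j ⁆

  ∈-copies-origin : ∀ y → y ∈ copies (origin y)
  ∈-copies-origin y = ∈-⋃⁺ ⊤ (λ j → ⁅ copyAt (origin y) j ⁆) ∈⊤
                        (subst (_∈ ⁅ copyAt (origin y) (layer y) ⁆) (copyAt-origin-layer y) (x∈⁅x⁆ _))

  preimage-∪-⁅⁆ : ∀ S i → preimage origin (S ∪ ⁅ i ⁆) ⊆ preimage origin S ∪ copies i
  preimage-∪-⁅⁆ S i {y} y∈ with x∈p∪q⁻ S ⁅ i ⁆ (∈-preimage⁻ y∈)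
  ... | inj₁ oy∈S = p⊆p∪q (copies i) (∈-preimage⁺ oy∈S)
  ... | inj₂ oy∈i =
    q⊆p∪q _ (copies i) (subst (λ i → y ∈ copies i) (x∈⁅y⁆⇒x≡y i oy∈i) (∈-copies-origin y))

  module _ (M : Matroid (length Lᵏ)) where

    rk-copies-≤ : ∀ i → rk M (copies i) ≤ k
    rk-copies-≤ i =
      ≤-trans (rk-⋃-≤ M 1 ⊤ _ (λ j → ≤-trans (rk-card M _) (≤-reflexive (∣⁅x⁆∣≡1 (copyAt i j)))))
              (≤-reflexive (trans (*-identityˡ _) (∣⊤∣≡n k)))

    rk-preimage-≤ : ∀ S → rk M (preimage origin S) ≤ k * ∣ S ∣
    rk-preimage-≤ S =
      ≤-trans (rk-mono M _ _ (λ {y} y∈ → ∈-⋃⁺ S copies (∈-preimage⁻ y∈) (∈-copies-origin y)))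
              (rk-⋃-≤ M k S copies rk-copies-≤)

-- Edges of F^k_e are addressed like those of F^k, by an edge of F and a layer in Fin k;
-- the single copy of e is put in layer j₀.
module Fᵏₑ-Position {m} (F : SimpleGraph m) (k : ℕ) (e : Fin (#E (mg F))) (j₀ : Fin k) where

  block : Fin (#E (mg F)) → List (Fin m × Fin m)
  block f = if ⌊ f ≟ e ⌋ then [ lookup (edges F) f ] else replicate k (lookup (edges F) f)

  open ConcatMapPosition block

  layerAt : ∀ f → Fin (length (block f)) → Fin k
  layerAt f t with f ≟ e
  ... | yes _ = j₀
  ... | no  _ = cast (length-replicate k) t

  layerAt-injective : ∀ f {t t′} → layerAt f t ≡ layerAt f t′ → t ≡ t′
  layerAt-injective f {t} {t′} eq with f ≟ e
  layerAt-injective f {zero} {zero} eq | yes _ = refl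
  ... | no  _ = trans (sym (cast-involutive (sym (length-replicate k)) (length-replicate k) t))
                (trans (cong (cast _) eq)
                       (cast-involutive (sym (length-replicate k)) (length-replicate k) t′))

  layerAt-e : ∀ f t → f ≡ e → layerAt f t ≡ j₀
  layerAt-e f t f≡e with f ≟ e
  ... | yes _   = refl
  ... | no  f≢e = contradiction f≡e f≢e

  position-of-e : ∀ f → f ≡ e → Fin (length (block f))
  position-of-e f f≡e with f ≟ e
  ... | yes _   = zero
  ... | no  f≢e = contradiction f≡e f≢e

  lookup-block : ∀ f t → lookup (block f) t ≡ lookup (edges F) f
  lookup-block f t with f ≟ e
  lookup-block f zero | yes _ = refl
  ... | no _ = lookup-replicate′ k (lookup (edges F) f) t

  edgeIndices : List (Fin (#E (mg F)))
  edgeIndices = tabulate id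

  origin : Fin (#E (Fke F k e)) → Fin (#E (mg F))
  origin y = lookup edgeIndices (proj₁ (split edgeIndices y))

  layer : Fin (#E (Fke F k e)) → Fin k
  layer y = layerAt (origin y) (proj₂ (split edgeIndices y))

  layer-e : ∀ y → origin y ≡ e → layer y ≡ j₀
  layer-e y = layerAt-e (origin y) _

  lookup-origin : ∀ y → lookup (Fke F k e) y ≡ lookup (edges F) (origin y)
  lookup-origin y = trans (lookup-split edgeIndices y) (lookup-block (origin y) _)

  origin-layer-injective : ∀ {y y′} → origin y ≡ origin y′ → layer y ≡ layer y′ → y ≡ y′
  origin-layer-injective o≡ l≡ =
    split-injective edgeIndices (position-≡ (lookup-tabulate-injective id o≡) l≡)
    where
    position-≡ : ∀ {p p′ : Position edgeIndices} → proj₁ p ≡ proj₁ p′ →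
                 layerAt (lookup edgeIndices (proj₁ p)) (proj₂ p) ≡
                 layerAt (lookup edgeIndices (proj₁ p′)) (proj₂ p′) →
                 p ≡ p′
    position-≡ {i , t} refl l≡ = cong (i ,_) (layerAt-injective (lookup edgeIndices i) l≡)

  e-has-origin : ∃ λ y → origin y ≡ e
  e-has-origin =
    join edgeIndices (i , position-of-e _ fᵢ≡e) ,
    trans (cong (lookup edgeIndices ∘ proj₁) (split-join edgeIndices _)) fᵢ≡e
    where
    i = cast (sym (length-tabulate id)) e
    fᵢ≡e : lookup edgeIndices i ≡ e
    fᵢ≡e = lookup-tabulate id e

module _ {n m} (G : SimpleGraph n) (F : SimpleGraph m) (k : ℕ) where
  open Blowup k (edges G)

  liftCopy : Copy (mg F) (mg G) → (x₀ : Fin (#E (mg F))) → Fin k → Copy (Fke F k x₀) (G ^[ k ])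
  liftCopy c x₀ j = record { φ = φ c ; φ-inj = φ-inj c ; ψ = ψ′ ; ψ-inj = ψ′-inj ; ψ-end = ψ′-end }
    where
    module Fᵏₑ = Fᵏₑ-Position F k x₀ j

    ψ′ : Fin (#E (Fke F k x₀)) → Fin (#E (G ^[ k ]))
    ψ′ y = copyAt (ψ c (Fᵏₑ.origin y)) (Fᵏₑ.layer y)

    ψ′-inj : Injective _≡_ _≡_ ψ′
    ψ′-inj eq = let i≡i′ , j≡j′ = copyAt-injective eq in Fᵏₑ.origin-layer-injective (ψ-inj c i≡i′) j≡j′

    ψ′-end : ∀ y → SameEdge (φ c (proj₁ (lookup (Fke F k x₀) y)) , φ c (proj₂ (lookup (Fke F k x₀) y)))
                            (lookup (G ^[ k ]) (ψ′ y))
    ψ′-end y = subst₂ (λ a b → SameEdge (φ c (proj₁ a) , φ c (proj₂ a)) b)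
                      (sym (Fᵏₑ.lookup-origin y)) (sym (lookup-copyAt _ _)) (ψ-end c (Fᵏₑ.origin y))

  module _ {S : Subset (#E (mg G))} {e} (c : Copy (mg F) (mg G))
           (c⊆S∪e : ∀ x → ψ c x ∈ S ∪ ⁅ e ⁆) {x₀} (ψx₀≡e : ψ c x₀ ≡ e) (j : Fin k) where
    module Fᵏₑ = Fᵏₑ-Position F k x₀ j

    ψ-liftCopy-x₀ : ∀ y → Fᵏₑ.origin y ≡ x₀ → ψ (liftCopy c x₀ j) y ≡ copyAt e j
    ψ-liftCopy-x₀ y oy≡x₀ = cong₂ copyAt (trans (cong (ψ c) oy≡x₀) ψx₀≡e) (Fᵏₑ.layer-e y oy≡x₀)

    copyAt-∈-liftCopy : copyAt e j ∈ edgeSet (liftCopy c x₀ j)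
    copyAt-∈-liftCopy = let y , oy≡x₀ = Fᵏₑ.e-has-origin in
      subst (_∈ edgeSet (liftCopy c x₀ j)) (ψ-liftCopy-x₀ y oy≡x₀) (∈-edgeSet⁺ (liftCopy c x₀ j) y)

    liftCopy-⊆ : edgeSet (liftCopy c x₀ j) - copyAt e j ⊆ preimage origin S
    liftCopy-⊆ {z} z∈E-copyAt with ∈-edgeSet⁻ (liftCopy c x₀ j) (p─q⊆p _ _ z∈E-copyAt)
    ... | y , refl with x∈p∪q⁻ S ⁅ e ⁆ (c⊆S∪e (Fᵏₑ.origin y))
    ...   | inj₁ ψoy∈S = ∈-preimage⁺ (subst (_∈ S) (sym (origin-copyAt _ _)) ψoy∈S)
    ...   | inj₂ ψoy∈e =
      contradiction (subst (_∈ ⁅ copyAt e j ⁆) (sym z≡copyAt) (x∈⁅x⁆ (copyAt e j))) (x∈p─q⇒x∉q _ _ z∈E-copyAt)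
      where
      z≡copyAt = ψ-liftCopy-x₀ y (ψ-inj c (trans (x∈⁅y⁆⇒x≡y e ψoy∈e) (sym ψx₀≡e)))

  module _ (M : Matroid (#E (G ^[ k ]))) (wsM : WeaklySatMatroid G F k M) where

    rank-≤-rk-preimage : ∀ {S} → WeaklySat G F S → rank M ≤ rk M (preimage origin S)
    rank-≤-rk-preimage done = rk-mono M ⊤ (preimage origin ⊤) (λ _ → ∈-preimage⁺ {f = origin} ∈⊤)
    rank-≤-rk-preimage (step S e _ c c⊆S∪e (x₀ , ψx₀≡e) wsS∪e) = begin
      rank M                               ≤⟨ rank-≤-rk-preimage wsS∪e ⟩
      rk M (preimage origin (S ∪ ⁅ e ⁆))   ≤⟨ rk-mono M _ _ (preimage-∪-⁅⁆ S e) ⟩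
      rk M (preimage origin S ∪ copies e)  ≤⟨ spans-⋃ M ⊤ _ S⊢copyAt ⟩
      rk M (preimage origin S)             ∎
      where
      open ≤-Reasoning
      S⊢copyAt : ∀ {j} → j ∈ ⊤ → Spans M (preimage origin S) ⁅ copyAt e j ⁆
      S⊢copyAt {j} _ = cycle⇒spans M (wsM x₀ (liftCopy c x₀ j))
                         (copyAt-∈-liftCopy c c⊆S∪e ψx₀≡e j) (liftCopy-⊆ c c⊆S∪e ψx₀≡e j)

lemma3 : ∀ {n m} (G : SimpleGraph n) (F : SimpleGraph m) (k : ℕ) → 1 ≤ k →
         (H : Subset (#E (mg G))) → WeaklySat G F H →
         (M : Matroid (#E (G ^[ k ]))) → WeaklySatMatroid G F k M →
         rank M ≤ k * ∣ H ∣
lemma3 G F k _ H wsH M wsM =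
  ≤-trans (rank-≤-rk-preimage G F k M wsM wsH) (Blowup.rk-preimage-≤ k (edges G) M H)
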